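{- Let $\mathfrak{X}=(\Omega,\mathcal{C})$ be a Jordan configuration. Then: (a) there exists a partition $\Omega_1,\dots,\Omega_f$ of $\Omega$ such that $1_{\Omega_i}\in\mathcal{C}$ for each $i$ (the fibers of $\mathfrak{X}$); (b) for every $C\in\mathcal{C}$ there exist fibers $\Omega_i,\Omega_j$ (not necessarily distinct) with $C\subseteq(\Omega_i\times\Omega_j)\cup(\Omega_j\times\Omega_i)$, and if $\omega,\omega'\in\Omega_i$ or $\omega,\omega'\in\Omega_j$ then $|C(\omega)|+|C^\top(\omega)|=|C(\omega')|+|C^\top(\omega')|$ (i.e. the graph $(\Omega_i\cup\Omega_j,C\cup C^\top)$ is bi-regular); (c) $\mathcal{C}$ is the disjoint union $\bigcup_{1\le a\le b\le f}\mathcal{C}^{ab}$, where $\mathcal{C}^{ab}=\{C\in\mathcal{C}: C\subseteq\Omega_a\times\Omega_b\cup\Omega_b\times\Omega_a\}$.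
   Context: $1_\Delta=\{(\omega,\omega):\omega\in\Delta\}$. For $R\subseteq\Omega^2$: $R(\alpha)=\{\beta:(\alpha,\beta)\in R\}$, $R^\top$ the transpose. A rainbow is a partition $\mathcal{C}$ of $\Omega^2$ such that $1_\Omega$ is a union of classes and $C^\top\in\mathcal{C}$ for all $C\in\mathcal{C}$. A Jordan configuration is a rainbow such that for all $C,D\in\mathcal{C}$ and all pairs $(\alpha,\beta),(\alpha',\beta')$ in the same class, $|C(\alpha)\cap D^\top(\beta)|+|D(\alpha)\cap C^\top(\beta)|=|C(\alpha')\cap D^\top(\beta')|+|D(\alpha')\cap C^\top(\beta')|$. -}

module Defs where

open import Data.Nat using (ℕ; zero; suc; _+_)
open import Data.Fin using (Fin; zero; suc; _≟_; _≤_)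
open import Data.Product using (Σ; ∃; ∃-syntax; _×_; _,_)
open import Data.Sum using (_⊎_)
open import Relation.Binary.PropositionalEquality using (_≡_)
open import Relation.Nullary using (yes; no)
open import Function.Bundles using (_⇔_)

#[_≡_] : ∀ {n m} → (Fin n → Fin m) → Fin m → ℕ
#[_≡_] {zero}  f k = 0
#[_≡_] {suc n} f k with f zero ≟ k
... | yes _ = suc (#[ (λ γ → f (suc γ)) ≡ k ])
... | no  _ = #[ (λ γ → f (suc γ)) ≡ k ]

#[_≡_∧_≡_] : ∀ {n m} → (Fin n → Fin m) → Fin m → (Fin n → Fin m) → Fin m → ℕ
#[_≡_∧_≡_] {zero}  f k g l = 0
#[_≡_∧_≡_] {suc n} f k g l with f zero ≟ k | g zero ≟ l
... | yes _ | yes _ = suc (#[ (λ γ → f (suc γ)) ≡ k ∧ (λ γ → g (suc γ)) ≡ l ])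
... | _     | _     = #[ (λ γ → f (suc γ)) ≡ k ∧ (λ γ → g (suc γ)) ≡ l ]

-- A partition 𝒞 of Ω² (Ω = Fin n) into m classes, given by a colouring
-- c : Ω → Ω → Fin m; the class with index C is {(α,β) : c α β ≡ C}.
-- Classes of a partition are nonempty: c is surjective.
IsPartition² : ∀ {n m} → (Fin n → Fin n → Fin m) → Set
IsPartition² {n} {m} c = ∀ (C : Fin m) → ∃[ α ] ∃[ β ] (c α β ≡ C)

-- Rainbow: partition, 1_Ω is a union of classes, closed under transpose.
IsRainbow : ∀ {n m} → (Fin n → Fin n → Fin m) → Set
IsRainbow {n} {m} c =
  IsPartition² c
  × (∀ (α β γ : Fin n) → c α α ≡ c β γ → β ≡ γ)
  × (∀ (C : Fin m) → ∃[ D ] (∀ (α β : Fin n) → (c α β ≡ C ⇔ c β α ≡ D)))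

-- |C(α) ∩ D^⊤(β)| = #{γ : (α,γ) ∈ C, (γ,β) ∈ D}
p : ∀ {n m} → (Fin n → Fin n → Fin m) → Fin m → Fin m → Fin n → Fin n → ℕ
p c C D α β = #[ (λ γ → c α γ) ≡ C ∧ (λ γ → c γ β) ≡ D ]

IsJordan : ∀ {n m} → (Fin n → Fin n → Fin m) → Set
IsJordan {n} {m} c =
  IsRainbow c
  × (∀ (C D : Fin m) (α β α' β' : Fin n) → c α β ≡ c α' β' →
       p c C D α β + p c D C α β ≡ p c C D α' β' + p c D C α' β')

deg : ∀ {n m} → (Fin n → Fin n → Fin m) → Fin m → Fin n → ℕ
deg c C ω = #[ (λ γ → c ω γ) ≡ C ] + #[ (λ γ → c γ ω) ≡ C ]

-- Fibres given by fib : Ω → Fin f (Ω_i = fib⁻¹(i)).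
-- C ⊆ (Ω_i × Ω_j) ∪ (Ω_j × Ω_i)
Sub : ∀ {n m f} → (Fin n → Fin n → Fin m) → (Fin n → Fin f) → Fin m → Fin f → Fin f → Set
Sub {n} c fib C i j = ∀ (α β : Fin n) → c α β ≡ C →
  (fib α ≡ i × fib β ≡ j) ⊎ (fib α ≡ j × fib β ≡ i)

DiagClass : ∀ {n m f} → (Fin n → Fin n → Fin m) → (Fin n → Fin f) → Fin f → Set
DiagClass {n} {m} c fib i = ∃[ C ] (∀ (α β : Fin n) → (c α β ≡ C ⇔ (α ≡ β × fib α ≡ i)))

-- The fibres are the classes of the diagonal colouring ω ↦ c ω ω. As 1_Ω is a union of
-- classes, for a diagonal class X the only X-arcs are loops, so |C(α) ∩ Xᵀ(β)| = [ββ ∈ X] and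
-- |X(α) ∩ Cᵀ(β)| = [αα ∈ X] whenever (α, β) ∈ C. Jordan's identity with D = X thus says
-- that the multiset of diagonal classes at the two ends of an arc of C does not depend on the
-- arc, which gives the fibre pair of C in (b) and (c). With D = Cᵀ at the loop (ω, ω) the
-- identity reads |C(ω)| + |Cᵀ(ω)|, which is therefore constant on each fibre.

module Submission where

open import Defs
open import Data.Nat using (ℕ; zero; suc; _+_)
open import Data.Nat.Properties using (+-cancelˡ-≡; +-identityʳ; +-comm; m+n≡0⇒m≡0)
open import Data.Fin using (Fin; _≤_; zero; suc; _≟_)
open import Data.Fin.Properties using (any?; suc-injective; 0≢1+n; ≤-antisym; ≤-total)
open import Data.Product using (∃-syntax; _×_; _,_; proj₁; proj₂)
open import Data.Sum using (_⊎_; inj₁; inj₂)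
open import Function using (_∘_)
open import Function.Bundles using (Equivalence; mk⇔)
open import Relation.Binary.Definitions using (DecidableEquality)
open import Relation.Binary.PropositionalEquality
  using (_≡_; _≢_; refl; sym; trans; cong; cong₂; subst; module ≡-Reasoning)
open import Relation.Nullary using (Dec; yes; no; contradiction)

count∧-empty : ∀ {n m} {f g : Fin n → Fin m} {k l : Fin m} →
  (∀ γ → f γ ≡ k → g γ ≢ l) → #[ f ≡ k ∧ g ≡ l ] ≡ 0
count∧-empty {zero} none = refl
count∧-empty {suc n} {f = f} {g} {k} {l} none with f zero ≟ k | g zero ≟ l
... | yes fk | yes gl = contradiction gl (none zero fk)
... | yes _  | no _   = count∧-empty (none ∘ suc)
... | no _   | _      = count∧-empty (none ∘ suc)

count∧-unique : ∀ {n m} {f g : Fin n → Fin m} {k l : Fin m} (β : Fin n) →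
  (∀ γ → f γ ≡ k → g γ ≡ l → γ ≡ β) → f β ≡ k → g β ≡ l → #[ f ≡ k ∧ g ≡ l ] ≡ 1
count∧-unique {suc n} {f = f} {g} {k} {l} zero only fk gl with f zero ≟ k | g zero ≟ l
... | yes _ | yes _  = cong suc (count∧-empty λ γ fγ gγ → 0≢1+n (sym (only (suc γ) fγ gγ)))
... | yes _ | no g≢l = contradiction gl g≢l
... | no f≢k | _     = contradiction fk f≢k
count∧-unique {suc n} {f = f} {g} {k} {l} (suc β) only fk gl with f zero ≟ k | g zero ≟ l
... | yes f0 | yes g0 with () ← only zero f0 g0
... | yes _ | no _   = count∧-unique β (λ γ fγ gγ → suc-injective (only (suc γ) fγ gγ)) fk gl
... | no _  | _      = count∧-unique β (λ γ fγ gγ → suc-injective (only (suc γ) fγ gγ)) fk gl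

count∧-≡-countˡ : ∀ {n m} {f g : Fin n → Fin m} {k l : Fin m} →
  (∀ γ → f γ ≡ k → g γ ≡ l) → #[ f ≡ k ∧ g ≡ l ] ≡ #[ f ≡ k ]
count∧-≡-countˡ {zero} _ = refl
count∧-≡-countˡ {suc n} {f = f} {g} {k} {l} f⇒g with f zero ≟ k | g zero ≟ l
... | yes _  | yes _  = cong suc (count∧-≡-countˡ (f⇒g ∘ suc))
... | yes fk | no g≢l = contradiction (f⇒g zero fk) g≢l
... | no _   | _      = count∧-≡-countˡ (f⇒g ∘ suc)

count∧-≡-countʳ : ∀ {n m} {f g : Fin n → Fin m} {k l : Fin m} →
  (∀ γ → g γ ≡ l → f γ ≡ k) → #[ f ≡ k ∧ g ≡ l ] ≡ #[ g ≡ l ]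
count∧-≡-countʳ {zero} _ = refl
count∧-≡-countʳ {suc n} {f = f} {g} {k} {l} g⇒f with f zero ≟ k | g zero ≟ l
... | yes _  | yes _ = cong suc (count∧-≡-countʳ (g⇒f ∘ suc))
... | no f≢k | yes gl = contradiction (g⇒f zero gl) f≢k
... | yes _  | no _  = count∧-≡-countʳ (g⇒f ∘ suc)
... | no _   | no _  = count∧-≡-countʳ (g⇒f ∘ suc)

𝟙 : ∀ {p} {P : Set p} → Dec P → ℕ
𝟙 (yes _) = 1
𝟙 (no _)  = 0

𝟙-yes : ∀ {p} {P : Set p} (d : Dec P) → P → 𝟙 d ≡ 1
𝟙-yes (yes _) _  = refl
𝟙-yes (no ¬p) pr = contradiction pr ¬p

module _ {ℓ} {A : Set ℓ} (_≟ᴬ_ : DecidableEquality A) where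

  -- 𝟙 (u ≟ᴬ x) + 𝟙 (v ≟ᴬ x) is the multiplicity of x in the multiset {u, v}.
  pair-from-multiplicities : ∀ {a b a′ b′ : A} →
    𝟙 (a ≟ᴬ a) + 𝟙 (b ≟ᴬ a) ≡ 𝟙 (a′ ≟ᴬ a) + 𝟙 (b′ ≟ᴬ a) →
    𝟙 (a ≟ᴬ b) + 𝟙 (b ≟ᴬ b) ≡ 𝟙 (a′ ≟ᴬ b) + 𝟙 (b′ ≟ᴬ b) →
    (a′ ≡ a × b′ ≡ b) ⊎ (a′ ≡ b × b′ ≡ a)
  pair-from-multiplicities {a} {b} {a′} {b′} at-a at-b with a′ ≟ᴬ a
  ... | yes refl with b′ ≟ᴬ b
  ...   | yes b′≡b = inj₁ (refl , b′≡b)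
  ...   | no _ = contradiction (trans (sym (𝟙-yes (b ≟ᴬ b) refl)) (+-cancelˡ-≡ _ _ _ at-b)) λ ()
  pair-from-multiplicities {a} {b} {a′} {b′} at-a at-b | no _ with b′ ≟ᴬ a | a′ ≟ᴬ b
  ...   | yes b′≡a | yes a′≡b = inj₂ (a′≡b , b′≡a)
  ...   | no _     | _ = contradiction (trans (sym (𝟙-yes (a ≟ᴬ a) refl)) (m+n≡0⇒m≡0 _ at-a)) λ ()
  ...   | yes refl | no _ =
    contradiction (trans (sym (𝟙-yes (b ≟ᴬ b) refl))
                         (+-cancelˡ-≡ _ _ _ (trans at-b (sym (+-identityʳ _))))) λ ()

  record Coimage {n} (d : Fin n → A) : Set ℓ where
    field
      size          : ℕ
      π             : Fin n → Fin size
      π-surjective  : ∀ i → ∃[ ω ] (π ω ≡ i)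
      π-≡⇒≡         : ∀ {x y} → π x ≡ π y → d x ≡ d y
      ≡⇒π-≡         : ∀ {x y} → d x ≡ d y → π x ≡ π y

  open Coimage

  coimage-extend-old : ∀ {n} {d : Fin (suc n) → A} (w : Fin n) → d (suc w) ≡ d zero →
    Coimage (d ∘ suc) → Coimage d
  coimage-extend-old {d = d} w dw≡d0 K = record
    { size = size K ; π = π′ ; π-surjective = surjective
    ; π-≡⇒≡ = λ {x} {y} → reflects x y ; ≡⇒π-≡ = λ {x} {y} → preserves x y }
    where
    π′ : Fin _ → Fin (size K)
    π′ zero    = π K w
    π′ (suc x) = π K x
    surjective : ∀ i → ∃[ ω ] (π′ ω ≡ i)
    surjective i with ω , πω≡i ← π-surjective K i = suc ω , πω≡i
    reflects : ∀ x y → π′ x ≡ π′ y → d x ≡ d y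
    reflects zero    zero    _ = refl
    reflects zero    (suc y) e = trans (sym dw≡d0) (π-≡⇒≡ K e)
    reflects (suc x) zero    e = trans (π-≡⇒≡ K e) dw≡d0
    reflects (suc x) (suc y) e = π-≡⇒≡ K e
    preserves : ∀ x y → d x ≡ d y → π′ x ≡ π′ y
    preserves zero    zero    _ = refl
    preserves zero    (suc y) e = ≡⇒π-≡ K (trans dw≡d0 e)
    preserves (suc x) zero    e = ≡⇒π-≡ K (trans e (sym dw≡d0))
    preserves (suc x) (suc y) e = ≡⇒π-≡ K e

  coimage-extend-new : ∀ {n} {d : Fin (suc n) → A} → (∀ w → d (suc w) ≢ d zero) →
    Coimage (d ∘ suc) → Coimage d
  coimage-extend-new {d = d} fresh K = record
    { size = suc (size K) ; π = π′ ; π-surjective = surjective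
    ; π-≡⇒≡ = λ {x} {y} → reflects x y ; ≡⇒π-≡ = λ {x} {y} → preserves x y }
    where
    π′ : Fin _ → Fin (suc (size K))
    π′ zero    = zero
    π′ (suc x) = suc (π K x)
    surjective : ∀ i → ∃[ ω ] (π′ ω ≡ i)
    surjective zero = zero , refl
    surjective (suc i) with ω , πω≡i ← π-surjective K i = suc ω , cong suc πω≡i
    reflects : ∀ x y → π′ x ≡ π′ y → d x ≡ d y
    reflects zero    zero    _ = refl
    reflects (suc x) (suc y) e = π-≡⇒≡ K (suc-injective e)
    preserves : ∀ x y → d x ≡ d y → π′ x ≡ π′ y
    preserves zero    zero    _ = refl
    preserves zero    (suc y) e = contradiction (sym e) (fresh y)
    preserves (suc x) zero    e = contradiction e (fresh x)
    preserves (suc x) (suc y) e = cong suc (≡⇒π-≡ K e)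

  coimage : ∀ {n} (d : Fin n → A) → Coimage d
  coimage {zero} d = record
    { size = 0 ; π = λ () ; π-surjective = λ () ; π-≡⇒≡ = λ { {()} } ; ≡⇒π-≡ = λ { {()} } }
  coimage {suc n} d with any? (λ w → d (suc w) ≟ᴬ d zero)
  ... | yes (w , dw≡d0) = coimage-extend-old w dw≡d0 (coimage (d ∘ suc))
  ... | no fresh        = coimage-extend-new (λ w e → fresh (w , e)) (coimage (d ∘ suc))

sorted-pair-unique : ∀ {f} {a b a′ b′ x y : Fin f} → a ≤ b → a′ ≤ b′ →
  (x ≡ a × y ≡ b) ⊎ (x ≡ b × y ≡ a) → (x ≡ a′ × y ≡ b′) ⊎ (x ≡ b′ × y ≡ a′) →
  a ≡ a′ × b ≡ b′
sorted-pair-unique _ _ (inj₁ (refl , refl)) (inj₁ (refl , refl)) = refl , refl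
sorted-pair-unique _ _ (inj₂ (refl , refl)) (inj₂ (refl , refl)) = refl , refl
sorted-pair-unique x≤y y≤x (inj₁ (refl , refl)) (inj₂ (refl , refl)) =
  ≤-antisym x≤y y≤x , ≤-antisym y≤x x≤y
sorted-pair-unique y≤x x≤y (inj₂ (refl , refl)) (inj₁ (refl , refl)) =
  ≤-antisym y≤x x≤y , ≤-antisym x≤y y≤x

module _ {n m f : ℕ} {c : Fin n → Fin n → Fin m} {fib : Fin n → Fin f} where

  Sub-swap : ∀ {C i j} → Sub c fib C i j → Sub c fib C j i
  Sub-swap sub α β αβ∈C with sub α β αβ∈C
  ... | inj₁ ends = inj₂ ends
  ... | inj₂ ends = inj₁ ends

  Sub-sorted : ∀ {C i j α β} → c α β ≡ C → Sub c fib C i j →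
    ∃[ a ] ∃[ b ] (a ≤ b × Sub c fib C a b
      × (∀ a′ b′ → a′ ≤ b′ → Sub c fib C a′ b′ → a ≡ a′ × b ≡ b′))
  Sub-sorted {i = i} {j} {α} {β} αβ∈C sub with ≤-total i j
  ... | inj₁ i≤j = i , j , i≤j , sub , λ a′ b′ a′≤b′ sub′ →
    sorted-pair-unique i≤j a′≤b′ (sub α β αβ∈C) (sub′ α β αβ∈C)
  ... | inj₂ j≤i = j , i , j≤i , Sub-swap sub , λ a′ b′ a′≤b′ sub′ →
    sorted-pair-unique j≤i a′≤b′ (Sub-swap sub α β αβ∈C) (sub′ α β αβ∈C)

module _ {n m : ℕ} {c : Fin n → Fin n → Fin m}
         (loops : ∀ α β γ → c α α ≡ c β γ → β ≡ γ) where

  p-into-diagonal : ∀ {C α β} x → c α β ≡ C → p c C (c x x) α β ≡ 𝟙 (c β β ≟ c x x)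
  p-into-diagonal {β = β} x αβ∈C with c β β ≟ c x x
  ... | yes ββ∈X = count∧-unique β (λ γ _ γβ∈X → loops x γ β (sym γβ∈X)) αβ∈C ββ∈X
  ... | no ββ∉X = count∧-empty λ γ _ γβ∈X →
    ββ∉X (subst (λ z → c z β ≡ c x x) (loops x γ β (sym γβ∈X)) γβ∈X)

  p-from-diagonal : ∀ {C α β} x → c α β ≡ C → p c (c x x) C α β ≡ 𝟙 (c α α ≟ c x x)
  p-from-diagonal {α = α} x αβ∈C with c α α ≟ c x x
  ... | yes αα∈X = count∧-unique α (λ γ αγ∈X _ → sym (loops x α γ (sym αγ∈X))) αα∈X αβ∈C
  ... | no αα∉X = count∧-empty λ γ αγ∈X _ →
    αα∉X (subst (λ z → c α z ≡ c x x) (sym (loops x α γ (sym αγ∈X))) αγ∈X)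

  diagonal-class-is-fibre : (K : Coimage _≟_ (λ ω → c ω ω)) → ∀ i →
    DiagClass c (Coimage.π K) i
  diagonal-class-is-fibre K i with ω , πω≡i ← Coimage.π-surjective K i =
    c ω ω , λ α β → mk⇔ (to α β) (from α β)
    where
    open Coimage K
    to : ∀ α β → c α β ≡ c ω ω → α ≡ β × π α ≡ i
    to α β αβ∈X with refl ← loops ω α β (sym αβ∈X) = refl , trans (≡⇒π-≡ αβ∈X) πω≡i
    from : ∀ α β → α ≡ β × π α ≡ i → c α β ≡ c ω ω
    from α .α (refl , πα≡i) = π-≡⇒≡ (trans πα≡i (sym πω≡i))

module _ {n m : ℕ} {c : Fin n → Fin n → Fin m} (J : IsJordan c) where

  private
    rainbow = proj₁ J
    nonempty = proj₁ rainbow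
    loops = proj₁ (proj₂ rainbow)
    transpose = proj₂ (proj₂ rainbow)
    jordan = proj₂ J

  ends-in-diagonal-class-invariant : ∀ {α β α′ β′} x → c α β ≡ c α′ β′ →
    𝟙 (c α α ≟ c x x) + 𝟙 (c β β ≟ c x x) ≡ 𝟙 (c α′ α′ ≟ c x x) + 𝟙 (c β′ β′ ≟ c x x)
  ends-in-diagonal-class-invariant {α} {β} {α′} {β′} x e = begin
    𝟙 (c α α ≟ X) + 𝟙 (c β β ≟ X)      ≡⟨ ends α β refl ⟨
    p c C X α β + p c X C α β          ≡⟨ jordan C X α β α′ β′ e ⟩
    p c C X α′ β′ + p c X C α′ β′      ≡⟨ ends α′ β′ (sym e) ⟩
    𝟙 (c α′ α′ ≟ X) + 𝟙 (c β′ β′ ≟ X)  ∎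
    where
    open ≡-Reasoning
    C = c α β
    X = c x x
    ends : ∀ γ δ → c γ δ ≡ C → p c C X γ δ + p c X C γ δ ≡ 𝟙 (c γ γ ≟ X) + 𝟙 (c δ δ ≟ X)
    ends γ δ γδ∈C = trans (cong₂ _+_ (p-into-diagonal loops x γδ∈C) (p-from-diagonal loops x γδ∈C))
                          (+-comm (𝟙 (c δ δ ≟ X)) (𝟙 (c γ γ ≟ X)))

  end-classes-invariant : ∀ {α β α′ β′} → c α β ≡ c α′ β′ →
    (c α′ α′ ≡ c α α × c β′ β′ ≡ c β β) ⊎ (c α′ α′ ≡ c β β × c β′ β′ ≡ c α α)
  end-classes-invariant {α} {β} e = pair-from-multiplicities _≟_
    (ends-in-diagonal-class-invariant α e) (ends-in-diagonal-class-invariant β e)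

  deg-invariant : ∀ C {ω ω′} → c ω ω ≡ c ω′ ω′ → deg c C ω ≡ deg c C ω′
  deg-invariant C {ω} {ω′} e with D , Cᵀ≡D ← transpose C = begin
    deg c C ω                      ≡⟨ deg-≡-p+p ω ⟨
    p c C D ω ω + p c D C ω ω      ≡⟨ jordan C D ω ω ω′ ω′ e ⟩
    p c C D ω′ ω′ + p c D C ω′ ω′  ≡⟨ deg-≡-p+p ω′ ⟩
    deg c C ω′                     ∎
    where
    open ≡-Reasoning
    deg-≡-p+p : ∀ w → p c C D w w + p c D C w w ≡ deg c C w
    deg-≡-p+p w = cong₂ _+_ (count∧-≡-countˡ λ γ → Equivalence.to (Cᵀ≡D w γ))
                            (count∧-≡-countʳ λ γ → Equivalence.to (Cᵀ≡D γ w))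

  module _ (K : Coimage _≟_ (λ ω → c ω ω)) where

    open Coimage K

    Sub-ends : ∀ {C α β} → c α β ≡ C → Sub c π C (π α) (π β)
    Sub-ends αβ∈C α′ β′ α′β′∈C with end-classes-invariant (trans αβ∈C (sym α′β′∈C))
    ... | inj₁ (αα , ββ) = inj₁ (≡⇒π-≡ αα , ≡⇒π-≡ ββ)
    ... | inj₂ (αβ , βα) = inj₂ (≡⇒π-≡ αβ , ≡⇒π-≡ βα)

    deg-constant-on-fibres : ∀ C {ω ω′} → π ω ≡ π ω′ → deg c C ω ≡ deg c C ω′
    deg-constant-on-fibres C = deg-invariant C ∘ π-≡⇒≡

    class-between-fibres : ∀ C → ∃[ i ] ∃[ j ] (Sub c π C i j
      × (∀ ω ω′ → (π ω ≡ i × π ω′ ≡ i) ⊎ (π ω ≡ j × π ω′ ≡ j) → deg c C ω ≡ deg c C ω′))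
    class-between-fibres C with α , β , αβ∈C ← nonempty C =
      π α , π β , Sub-ends αβ∈C , λ ω ω′ → deg-constant-on-fibres C ∘ same-fibre
      where
      same-fibre : ∀ {x y i j : Fin size} → (x ≡ i × y ≡ i) ⊎ (x ≡ j × y ≡ j) → x ≡ y
      same-fibre (inj₁ (refl , refl)) = refl
      same-fibre (inj₂ (refl , refl)) = refl

    class-between-sorted-fibres : ∀ C → ∃[ a ] ∃[ b ] (a ≤ b × Sub c π C a b
      × (∀ a′ b′ → a′ ≤ b′ → Sub c π C a′ b′ → a ≡ a′ × b ≡ b′))
    class-between-sorted-fibres C with α , β , αβ∈C ← nonempty C = Sub-sorted αβ∈C (Sub-ends αβ∈C)

proposition2p1 : ∀ (n m : ℕ) (c : Fin n → Fin n → Fin m) → IsJordan c →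
    ∃[ f ] ∃[ fib ] (
      -- (a) fib : Ω → Fin f is a partition into nonempty fibres, each 1_{Ω_i} ∈ 𝒞
      (∀ (i : Fin f) → ∃[ ω ] (fib ω ≡ i))
      × (∀ (i : Fin f) → DiagClass c fib i)
      -- (b)
      × (∀ (C : Fin m) → ∃[ i ] ∃[ j ] (Sub c fib C i j
          × (∀ (ω ω' : Fin n) → ((fib ω ≡ i × fib ω' ≡ i) ⊎ (fib ω ≡ j × fib ω' ≡ j)) →
               deg c C ω ≡ deg c C ω')))
      -- (c) each class lies in exactly one 𝒞^{ab}, a ≤ b
      × (∀ (C : Fin m) → ∃[ a ] ∃[ b ] (a ≤ b × Sub c fib C a b
          × (∀ (a' b' : Fin f) → a' ≤ b' → Sub c fib C a' b' → (a ≡ a' × b ≡ b')))))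
proposition2p1 n m c J =
  size , π , π-surjective , diagonal-class-is-fibre (proj₁ (proj₂ (proj₁ J))) K ,
  class-between-fibres J K , class-between-sorted-fibres J K
  where
  K = coimage _≟_ (λ ω → c ω ω)
  open Coimage K
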